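{- For every $t\in\mathrm{CL}(\mathcal{B})$ and every variable $x$ we have $[x]_{T_{ -\eta}}t=[x]_{T'_{ -\eta}}t$ (syntactic identity).
   Context: Lambda-terms are considered up to $\alpha$-equivalence; $\mathrm{FV}(t)$ is the set of free variables of $t$. Fix the closed lambda-terms (combinators) $\mathsf{S}=\lambda xyz.xz(yz)$, $\mathsf{K}=\lambda xy.x$, $\mathsf{I}=\lambda x.x$, $\mathsf{B}=\lambda xyz.x(yz)$, $\mathsf{C}=\lambda xyz.xzy$, $\mathsf{S}'=\lambda kxyz.k(xz)(yz)$, $\mathsf{B}'=\lambda kxyz.kx(yz)$, $\mathsf{C}'=\lambda kxyz.k(xz)y$. Let $\mathcal{B}=\{\mathsf{S},\mathsf{K},\mathsf{I},\mathsf{B},\mathsf{C},\mathsf{S}',\mathsf{B}',\mathsf{C}'\}$ and let $\mathrm{CL}(\mathcal{B})$ be the set of terms built from variables and elements of $\mathcal{B}$ using only application (left-associative). Equality of such terms is syntactic identity, combinators treated as atoms. Algorithm $T_{ -\eta}$: for a variable $x$ and $t\in\mathrm{CL}(\mathcal{B})$, $[x]_{T_{ -\eta}} t$ (written $[x]t$ below) is given by the first applicable equation: (1) $[x]t=\mathsf{K}t$ if $x\notin\mathrm{FV}(t)$; (2) $[x]x=\mathsf{I}$; (6) $[x](u s t)=\mathsf{B}'us([x]t)$ if $x\notin\mathrm{FV}(us)$; (7) $[x](u s t)=\mathsf{C}'u([x]s)t$ if $x\notin\mathrm{FV}(ut)$; (8) $[x](u s t)=\mathsf{S}'u([x]s)([x]t)$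 if $x\notin\mathrm{FV}(u)$; (9) $[x](s t)=\mathsf{B}s([x]t)$ if $x\notin\mathrm{FV}(s)$; (10) $[x](s t)=\mathsf{C}([x]s)t$ if $x\notin\mathrm{FV}(t)$; (11) $[x](s t)=\mathsf{S}([x]s)([x]t)$. Algorithm $T'_{ -\eta}$: $[x](st)=\mathrm{Opt}(\mathsf{S}([x]s)([x]t))$; $[x]x=\mathsf{I}$; $[x]t=\mathsf{K}t$ otherwise (for $t$ a variable other than $x$ or a constant), earlier equations taking precedence, where $\mathrm{Opt}$ is given by the first applicable clause: $\mathrm{Opt}(\mathsf{S}(\mathsf{K}s)(\mathsf{K}t))=\mathsf{K}(st)$; $\mathrm{Opt}(\mathsf{S}(\mathsf{K}(us))t)=\mathsf{B}'ust$; $\mathrm{Opt}(\mathsf{S}(\mathsf{K}s)t)=\mathsf{B}st$; $\mathrm{Opt}(\mathsf{S}(\mathsf{B}us)(\mathsf{K}t))=\mathsf{C}'ust$; $\mathrm{Opt}(\mathsf{S}(\mathsf{B}'u_1u_2s)(\mathsf{K}t))=\mathsf{C}'(u_1u_2)st$; $\mathrm{Opt}(\mathsf{S}s(\mathsf{K}t))=\mathsf{C}st$; $\mathrm{Opt}(\mathsf{S}(\mathsf{B}us)t)=\mathsf{S}'ust$; $\mathrm{Opt}(\mathsf{S}(\mathsf{B}'u_1u_2s)t)=\mathsf{S}'(u_1u_2)st$; $\mathrm{Opt}(\mathsf{S}st)=\mathsf{S}st$. -}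

module Defs where

open import Data.Nat using (ℕ; _≡ᵇ_)
open import Data.Bool using (Bool; true; false; _∨_; not; if_then_else_)
open import Data.Maybe using (Maybe; just; nothing)
open import Data.Product using (_×_; _,_)

data Comb : Set where
  cS cK cI cB cC cS' cB' cC' : Comb

data Term : Set where
  var : ℕ → Term
  con : Comb → Term
  _·_ : Term → Term → Term

infixl 9 _·_

occurs : ℕ → Term → Bool
occurs x (var y) = x ≡ᵇ y
occurs x (con c) = false
occurs x (s · t) = occurs x s ∨ occurs x t

-- Algorithm T_{-η}: first applicable equation among (1),(2),(6)-(11)

mutual
  absT : ℕ → Term → Term
  absT x t = if not (occurs x t) then con cK · t else absT₂ x t

  absT₂ : ℕ → Term → Term
  absT₂ x (var y) = con cI            -- only x itself contains x: (2)
  absT₂ x (con c) = con cK · con c    -- unreachable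
  absT₂ x ((u · s) · t) =
    if not (occurs x (u · s)) then con cB' · u · s · absT x t           -- (6)
    else if not (occurs x u ∨ occurs x t) then con cC' · u · absT x s · t  -- (7)
    else if not (occurs x u) then con cS' · u · absT x s · absT x t     -- (8)
    else absApp x (u · s) t
  absT₂ x (var y · t) = absApp x (var y) t
  absT₂ x (con c · t) = absApp x (con c) t

  -- equations (9)-(11) for [x](s t)
  absApp : ℕ → Term → Term → Term
  absApp x s t =
    if not (occurs x s) then con cB · s · absT x t                     -- (9)
    else if not (occurs x t) then con cC · absT x s · t                -- (10)
    else con cS · absT x s · absT x t                                  -- (11)

-- Algorithm T'_{-η} with the optimisation Opt

viewK : Term → Maybe Term
viewK (con cK · a) = just a
viewK _ = nothing

viewB : Term → Maybe (Term × Term)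
viewB (con cB · u · s) = just (u , s)
viewB _ = nothing

viewB' : Term → Maybe (Term × Term × Term)
viewB' (con cB' · u₁ · u₂ · s) = just (u₁ , u₂ , s)
viewB' _ = nothing

viewApp : Term → Maybe (Term × Term)
viewApp (u · s) = just (u , s)
viewApp _ = nothing

-- Opt (S s t), clauses tried in order
Opt : Term → Term → Term
Opt s t = opt1 (viewK s) (viewK t)
  where
  opt789 : Term
  opt789 with viewB s
  ... | just (u , s') = con cS' · u · s' · t
  ... | nothing with viewB' s
  ...   | just (u₁ , u₂ , s') = con cS' · (u₁ · u₂) · s' · t
  ...   | nothing = con cS · s · t

  opt456 : Maybe Term → Term
  opt456 (just t') with viewB s
  ... | just (u , s') = con cC' · u · s' · t'
  ... | nothing with viewB' s
  ...   | just (u₁ , u₂ , s') = con cC' · (u₁ · u₂) · s' · t'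
  ...   | nothing = con cC · s · t'
  opt456 nothing = opt789

  opt1 : Maybe Term → Maybe Term → Term
  opt1 (just s') (just t') = con cK · (s' · t')
  opt1 (just s') nothing with viewApp s'
  ... | just (u , s'') = con cB' · u · s'' · t
  ... | nothing = con cB · s' · t
  opt1 nothing mt = opt456 mt

absT' : ℕ → Term → Term
absT' x (s · t) = Opt (absT' x s) (absT' x t)
absT' x (var y) = if x ≡ᵇ y then con cI else con cK · var y
absT' x (con c) = con cK · con c

-- Structural induction on t, comparing the side conditions of T_{-η} with the
-- patterns of Opt. [x]'t is K t exactly when x ∉ FV(t), so the K-patterns of Opt
-- fire exactly when equations (1), (6)-(9) apply. When x occurs in the operator
-- of an application, [x]'(s t) is headed by S, S', C or C', never by K, B or B';
-- hence in equations (10) and (11) the first argument of S is matched by none of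
-- the K/B/B' patterns and Opt falls through to C or S.
module Submission where

open import Defs
open import Data.Nat using (ℕ)
open import Data.Bool using (true; false)
open import Data.Bool.Properties using (¬-not; ∨-conicalˡ; ∨-conicalʳ) renaming (_≟_ to _≟ᵇ_)
open import Data.Maybe using (just; nothing)
open import Data.Product using (_×_; _,_; proj₁)
open import Relation.Nullary using (yes; no)
open import Relation.Binary.PropositionalEquality using (_≡_; refl; sym; trans; cong; cong₂)

Inert : Term → Set
Inert s = viewK s ≡ nothing × viewB s ≡ nothing × viewB' s ≡ nothing

optB : Term → Term → Term
optB (u₁ · u₂) b = con cB' · u₁ · u₂ · b
optB u         b = con cB · u · b

optB-notK : ∀ u b → viewK (optB u b) ≡ nothing
optB-notK (var y)   b = refl
optB-notK (con c)   b = refl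
optB-notK (u₁ · u₂) b = refl

Opt-K-notK : ∀ u {b} → viewK b ≡ nothing → Opt (con cK · u) b ≡ optB u b
Opt-K-notK (var y)   eq rewrite eq = refl
Opt-K-notK (con c)   eq rewrite eq = refl
Opt-K-notK (u₁ · u₂) eq rewrite eq = refl

Opt-optB-K : ∀ u b t → Opt (optB u b) (con cK · t) ≡ con cC' · u · b · t
Opt-optB-K (var y)   b t = refl
Opt-optB-K (con c)   b t = refl
Opt-optB-K (u₁ · u₂) b t = refl

Opt-optB-notK : ∀ u b {c} → viewK c ≡ nothing → Opt (optB u b) c ≡ con cS' · u · b · c
Opt-optB-notK (var y)   b eq rewrite eq = refl
Opt-optB-notK (con k)   b eq rewrite eq = refl
Opt-optB-notK (u₁ · u₂) b eq rewrite eq = refl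

Opt-inert-K : ∀ {s} t → Inert s → Opt s (con cK · t) ≡ con cC · s · t
Opt-inert-K t (e₁ , e₂ , e₃) rewrite e₁ | e₂ | e₃ = refl

Opt-inert-notK : ∀ {s t} → Inert s → viewK t ≡ nothing → Opt s t ≡ con cS · s · t
Opt-inert-notK (e₁ , e₂ , e₃) et rewrite e₁ | et | e₂ | e₃ = refl

Opt-notKˡ-inert : ∀ {s} t → viewK s ≡ nothing → Inert (Opt s t)
Opt-notKˡ-inert {s} t es rewrite es with viewK t
... | just _ with viewB s
...   | just _ = refl , refl , refl
...   | nothing with viewB' s
...     | just _  = refl , refl , refl
...     | nothing = refl , refl , refl
Opt-notKˡ-inert {s} t es | nothing with viewB s
...   | just _ = refl , refl , refl
...   | nothing with viewB' s
...     | just _  = refl , refl , refl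
...     | nothing = refl , refl , refl

occurs-app-freshˡ : ∀ x s t → occurs x s ≡ false → occurs x (s · t) ≡ true → occurs x t ≡ true
occurs-app-freshˡ x s t es e rewrite es = e

occurs-app-boundˡ : ∀ x s t → occurs x s ≡ true → occurs x (s · t) ≡ true
occurs-app-boundˡ x s t es rewrite es = refl

absT'-fresh : ∀ x t → occurs x t ≡ false → absT' x t ≡ con cK · t
absT'-fresh x (var y) eq rewrite eq = refl
absT'-fresh x (con c) eq = refl
absT'-fresh x (s · t) eq
  rewrite absT'-fresh x s (∨-conicalˡ (occurs x s) (occurs x t) eq)
        | absT'-fresh x t (∨-conicalʳ (occurs x s) (occurs x t) eq) = refl

absT'-notK : ∀ x t → occurs x t ≡ true → viewK (absT' x t) ≡ nothing
absT'-notK x (var y) eq rewrite eq = refl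
absT'-notK x (s · t) eq with occurs x s in es
... | true  = proj₁ (Opt-notKˡ-inert (absT' x t) (absT'-notK x s es))
... | false rewrite absT'-fresh x s es | Opt-K-notK s (absT'-notK x t eq) = optB-notK s (absT' x t)

absT'-var-inert : ∀ x y → occurs x (var y) ≡ true → Inert (absT' x (var y))
absT'-var-inert x y eq rewrite eq = refl , refl , refl

absT'-app-inert : ∀ x u s → occurs x u ≡ true → Inert (absT' x (u · s))
absT'-app-inert x u s eu = Opt-notKˡ-inert (absT' x s) (absT'-notK x u eu)

absT≡absT'-var : ∀ x y → absT x (var y) ≡ absT' x (var y)
absT≡absT'-var x y with occurs x (var y)
... | true  = refl
... | false = refl

absT₂-boundOperator : ∀ x u s t → occurs x u ≡ true → absT₂ x ((u · s) · t) ≡ absApp x (u · s) t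
absT₂-boundOperator x u s t eu rewrite eu = refl

absApp-freshHead : ∀ x s t {b} → occurs x s ≡ false → absT x t ≡ b → absApp x s t ≡ con cB · s · b
absApp-freshHead x s t es refl rewrite es = refl

absApp-inertHead : ∀ x s t → occurs x s ≡ true → Inert (absT' x s) →
                   absT x s ≡ absT' x s → absT x t ≡ absT' x t →
                   absApp x s t ≡ Opt (absT' x s) (absT' x t)
absApp-inertHead x s t es inert ihs iht rewrite es | ihs with occurs x t in et
... | false rewrite absT'-fresh x t et = sym (Opt-inert-K t inert)
... | true  rewrite iht = sym (Opt-inert-notK inert (absT'-notK x t et))

mutual
  absT≡absT' : ∀ t x → absT x t ≡ absT' x t
  absT≡absT' t x with occurs x t in e
  ... | false = sym (absT'-fresh x t e)
  ... | true  = absT₂≡absT' t x e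

  absT₂≡absT' : ∀ t x → occurs x t ≡ true → absT₂ x t ≡ absT' x t
  absT₂≡absT' (var y) x e rewrite e = refl
  absT₂≡absT' (con c · t) x e =
    trans (absApp-freshHead x (con c) t refl (absT≡absT' t x))
          (sym (Opt-K-notK (con c) (absT'-notK x t e)))
  -- Splitting on _≟ᵇ_ instead of `with occurs x (var y)` keeps that expression
  -- unabstracted in the goal, so it still matches the types of the lemmas applied.
  absT₂≡absT' (var y · t) x e with occurs x (var y) ≟ᵇ true
  ... | yes ey = absApp-inertHead x (var y) t ey (absT'-var-inert x y ey)
                   (absT≡absT'-var x y) (absT≡absT' t x)
  ... | no ey  rewrite absT'-fresh x (var y) (¬-not ey) =
    trans (absApp-freshHead x (var y) t (¬-not ey) (absT≡absT' t x))
          (sym (Opt-K-notK (var y) (absT'-notK x t (occurs-app-freshˡ x (var y) t (¬-not ey) e))))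
  -- The induction hypothesis for u · s is taken here: inside a with-function u · s is
  -- no longer recognised as a subterm.
  absT₂≡absT' ((u · s) · t) x e = absT₂≡absT'-operatorApp u s t x e (absT≡absT' (u · s) x)

  absT₂≡absT'-operatorApp : ∀ u s t x → occurs x ((u · s) · t) ≡ true → absT x (u · s) ≡ absT' x (u · s) →
                            absT₂ x ((u · s) · t) ≡ absT' x ((u · s) · t)
  absT₂≡absT'-operatorApp u s t x e ihus with occurs x u ≟ᵇ true
  ... | yes eu = trans (absT₂-boundOperator x u s t eu)
                   (absApp-inertHead x (u · s) t (occurs-app-boundˡ x u s eu) (absT'-app-inert x u s eu)
                     ihus (absT≡absT' t x))
  ... | no eu  = absT₂≡absT'-freshOperator u s t x (¬-not eu) e

  absT₂≡absT'-freshOperator : ∀ u s t x → occurs x u ≡ false → occurs x ((u · s) · t) ≡ true →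
                              absT₂ x ((u · s) · t) ≡ absT' x ((u · s) · t)
  absT₂≡absT'-freshOperator u s t x eu e rewrite eu | absT'-fresh x u eu
    with occurs x s in es | occurs x t in et
  ... | false | true  rewrite absT'-fresh x s es =
    trans (cong (con cB' · u · s ·_) (absT₂≡absT' t x et))
          (sym (Opt-K-notK (u · s) (absT'-notK x t et)))
  ... | true  | false rewrite absT'-fresh x t et | Opt-K-notK u (absT'-notK x s es) =
    trans (cong (λ a → con cC' · u · a · t) (absT₂≡absT' s x es))
          (sym (Opt-optB-K u (absT' x s) t))
  ... | true  | true  rewrite Opt-K-notK u (absT'-notK x s es) =
    trans (cong₂ (λ a b → con cS' · u · a · b) (absT₂≡absT' s x es) (absT₂≡absT' t x et))
          (sym (Opt-optB-notK u (absT' x s) (absT'-notK x t et)))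

mainTheorem2 : (t : Term) (x : ℕ) → absT x t ≡ absT' x t
mainTheorem2 = absT≡absT'
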